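{- Let $n\ge3$ and $\lambda,\mu\in S_{2n}$ with $\mathrm{par}(\lambda)=\mathrm{par}(\mu)$. If there exists a destroying triple $(i,j,k)$ on $(\lambda,\mu)$, then $\mathrm{class}(\lambda)\ne\mathrm{class}(\mu)$.
   Context: A Dyck path of size $n$ is a word in $\mathtt{u},\mathtt{d}$ with $n$ of each letter whose every prefix has at least as many $\mathtt{u}$'s as $\mathtt{d}$'s; $\mathcal{D}_n$ is their set. The tunneling $\tau_D\in S_{2n}$ of $D$ is the fixed-point-free involution pairing each up-step position with the position of its matching down-step. For $\sigma\in S_{2n}$, $\sigma_k=\sigma(k)$, $\sigma_{[k]}=\{\sigma_1,\dots,\sigma_k\}$; the $\sigma$-path $\sigma(D)$ has $\sigma(D)_k=\mathtt{u}$ if $\tau_D(\sigma_k)\notin\sigma_{[k]}$ and $\mathtt{d}$ otherwise. $\lambda\sim\mu$ iff $\lambda(D)=\mu(D)$ for all $D\in\mathcal{D}_n$; $\mathrm{class}(\sigma)$ is the class of $\sigma$. The parity $\mathrm{par}(\sigma)=(a,b)$: $a$ is the smallest positive integer with $\sigma_a\not\equiv\sigma_{a+1}\pmod2$, $b$ is the smallest positive integer with $\sigma_{2n+1-b}\not\equiv\sigma_{2n-b}\pmod2$. For $\lambda,\mu\in S_{2n}$, a triple of integers $(i,j,k)$ with $1\le i<j<k\le 2n$ is a destroying triple on $(\lambda,\mu)$ if there exist four distinct integers $P,P+1,Q,R\in[2n]$ with $Q\not\equiv R\pmod 2$ such that either $\{\lambda_i,\lambda_j\}=\{P,P+1\}$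 and $\{\mu_j,\mu_k\}=\{Q,R\}$, or $\{\lambda_i,\lambda_j\}=\{Q,R\}$ and $\{\mu_j,\mu_k\}=\{P,P+1\}$. -}

module Defs where

open import Data.Nat using (ℕ; zero; suc; _+_; _*_; _∸_; _≤_; _<_; _≤?_; _<?_; _%_)
open import Data.Nat.Properties using (_≟_)
open import Data.Fin using (Fin; toℕ)
open import Data.Fin.Properties using (any?; all?)
open import Data.Fin.Permutation using (Permutation′; _⟨$⟩ʳ_)
open import Data.Vec using (Vec; lookup; tabulate; toList)
open import Data.List using (List; length; filter; take)
open import Data.Bool using (Bool; true; false; if_then_else_)
open import Data.Product using (Σ; ∃; _×_; _,_)
open import Data.Sum using (_⊎_)
open import Relation.Nullary using (¬_; Dec; does; yes; no)
open import Relation.Nullary.Decidable using (_×-dec_; _⊎-dec_; _→-dec_)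
open import Relation.Binary.PropositionalEquality using (_≡_; _≢_)

-- Conventions: positions 1..2n and values 1..2n of the paper are
-- represented 0-indexed, by Fin (2 * n).  Shifting all values by one
-- preserves "P, P+1" consecutiveness and congruence mod 2.

data Step : Set where
  u d : Step

isU : Step → Bool
isU u = true
isU d = false

isD : Step → Bool
isD u = false
isD d = true

Word : ℕ → Set
Word m = Vec Step m

ups : ∀ {m} → Word m → ℕ → ℕ
ups D k = length (filter (λ s → isU s ≡? true) (take k (toList D)))
  where
  open import Data.Bool.Properties renaming (_≟_ to _≡?_)

downs : ∀ {m} → Word m → ℕ → ℕ
downs D k = length (filter (λ s → isD s ≡? true) (take k (toList D)))
  where
  open import Data.Bool.Properties renaming (_≟_ to _≡?_)

IsDyck : (n : ℕ) → Word (2 * n) → Set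
IsDyck n D = ups D (2 * n) ≡ n × downs D (2 * n) ≡ n
           × (∀ k → k ≤ 2 * n → downs D k ≤ ups D k)

-- Matched D x y : the up-step at position x is matched with the
-- down-step at position y (the height after the first y+1 letters
-- returns to the height before letter x for the first time after x).
Matched : ∀ {m} → Word m → Fin m → Fin m → Set
Matched {m} D x y =
  toℕ x < toℕ y × lookup D x ≡ u
  × ups D (suc (toℕ y)) + downs D (toℕ x) ≡ ups D (toℕ x) + downs D (suc (toℕ y))
  × (∀ (z : Fin m) → toℕ x < toℕ z → toℕ z ≤ toℕ y →
       ups D (toℕ x) + downs D (toℕ z) < ups D (toℕ z) + downs D (toℕ x))

step? : (a b : Step) → Dec (a ≡ b)
step? u u = yes _≡_.refl
step? u d = no λ ()
step? d u = no λ ()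
step? d d = yes _≡_.refl

Matched? : ∀ {m} (D : Word m) x y → Dec (Matched D x y)
Matched? {m} D x y =
  (toℕ x <? toℕ y) ×-dec (step? (lookup D x) u)
  ×-dec (ups D (suc (toℕ y)) + downs D (toℕ x) ≟ ups D (toℕ x) + downs D (suc (toℕ y)))
  ×-dec all? (λ z → (toℕ x <? toℕ z) →-dec ((toℕ z ≤? toℕ y) →-dec
          (ups D (toℕ x) + downs D (toℕ z) <? ups D (toℕ z) + downs D (toℕ x))))

-- The tunneling τ_D as a relation: τ_D(a) = b
Tunnel : ∀ {m} → Word m → Fin m → Fin m → Set
Tunnel D a b = Matched D a b ⊎ Matched D b a

Tunnel? : ∀ {m} (D : Word m) a b → Dec (Tunnel D a b)
Tunnel? D a b = Matched? D a b ⊎-dec Matched? D b a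

σpath : ∀ {m} → Permutation′ m → Word m → Word m
σpath σ D = tabulate λ k →
  if does (any? (λ l → (toℕ l ≤? toℕ k) ×-dec Tunnel? D (σ ⟨$⟩ʳ k) (σ ⟨$⟩ʳ l)))
  then d else u

_∼_ : ∀ {n} → Permutation′ (2 * n) → Permutation′ (2 * n) → Set
_∼_ {n} λ′ μ = ∀ (D : Word (2 * n)) → IsDyck n D → σpath λ′ D ≡ σpath μ D

-- value of σ at 0-indexed position i (as a natural number); only used
-- at positions i < 2n
val : ∀ {m} → Permutation′ m → ℕ → ℕ
val {m} σ i with i <? m
... | yes i<m = toℕ (σ ⟨$⟩ʳ Data.Fin.fromℕ< i<m)
  where import Data.Fin
... | no _ = 0

ParDiff : ∀ {m} → Permutation′ m → ℕ → ℕ → Set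
ParDiff σ i j = val σ i % 2 ≢ val σ j % 2

-- a is the first component of par(σ): the smallest positive a with
-- σ_a ≢ σ_{a+1} (mod 2)   (1-indexed positions a, a+1 are 0-indexed a-1, a)
ParFst : ∀ {m} → Permutation′ m → ℕ → Set
ParFst {m} σ a = 1 ≤ a × a < m × ParDiff σ (a ∸ 1) a
  × (∀ a′ → 1 ≤ a′ → a′ < a → ¬ ParDiff σ (a′ ∸ 1) a′)

-- b is the second component of par(σ): the smallest positive b with
-- σ_{2n+1-b} ≢ σ_{2n-b} (mod 2)  (0-indexed positions m-b and m-b-1)
ParSnd : ∀ {m} → Permutation′ m → ℕ → Set
ParSnd {m} σ b = 1 ≤ b × b < m × ParDiff σ (m ∸ b) (m ∸ b ∸ 1)
  × (∀ b′ → 1 ≤ b′ → b′ < b → ¬ ParDiff σ (m ∸ b′) (m ∸ b′ ∸ 1))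

Par : ∀ {m} → Permutation′ m → ℕ × ℕ → Set
Par σ (a , b) = ParFst σ a × ParSnd σ b

SetEq2 : ℕ → ℕ → ℕ → ℕ → Set
SetEq2 x y p q = (x ≡ p × y ≡ q) ⊎ (x ≡ q × y ≡ p)

DestroyingTriple : ∀ {m} → Permutation′ m → Permutation′ m → Fin m → Fin m → Fin m → Set
DestroyingTriple {m} λ′ μ i j k =
  toℕ i < toℕ j × toℕ j < toℕ k ×
  Σ ℕ λ P → Σ ℕ λ Q → Σ ℕ λ R →
    suc P < m × Q < m × R < m
    × P ≢ Q × P ≢ R × suc P ≢ Q × suc P ≢ R × Q ≢ R
    × Q % 2 ≢ R % 2
    × ( (SetEq2 (ℓ i) (ℓ j) P (suc P) × SetEq2 (m′ j) (m′ k) Q R)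
      ⊎ (SetEq2 (ℓ i) (ℓ j) Q R × SetEq2 (m′ j) (m′ k) P (suc P)))
  where
  ℓ m′ : Fin m → ℕ
  ℓ x = toℕ (λ′ ⟨$⟩ʳ x)
  m′ x = toℕ (μ ⟨$⟩ʳ x)

-- A destroying triple makes λ and μ read the same position j differently
-- on a suitable Dyck path: one needs a Dyck path whose tunneling pairs P
-- with P + 1 (a peak) and also Q with R.  The latter is possible because Q
-- and R have opposite parity: take the zigzag udud…, raise it by one level
-- between Q and R, and insert a peak at P.  If λ maps {i, j} and μ maps
-- {j, k} onto these two pairs, then letter j of the λ-path is d (its
-- partner λ_i was already seen) while letter j of the μ-path is u (its
-- partner μ_k comes later).
module Submission where

open import Defs
open import Data.Nat using (ℕ; zero; suc; _+_; _*_; _≤_; _<_; _%_; _<?_; _≤?_; z≤n; s≤s; s≤s⁻¹)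
open import Data.Nat.Properties
open import Data.Nat.DivMod using ([m+n]%n≡m%n)
open import Data.Fin using (Fin; toℕ; fromℕ<)
open import Data.Fin.Properties using (toℕ-fromℕ<; toℕ<n; toℕ-injective; any?)
open import Data.Fin.Permutation using (Permutation′; _⟨$⟩ʳ_; _⟨$⟩ˡ_; inverseˡ)
open import Data.Vec using (_∷_; tabulate; lookup)
open import Data.Vec.Properties using (lookup∘tabulate)
open import Data.Bool using (if_then_else_)
open import Data.Empty using (⊥; ⊥-elim)
open import Data.Product using (Σ; ∃; _×_; _,_)
open import Data.Sum using (_⊎_; inj₁; inj₂; swap; [_,_]′)
open import Function using (_∘_)
open import Relation.Binary using (tri<; tri≈; tri>)
open import Relation.Binary.PropositionalEquality
open import Relation.Nullary using (¬_; Dec; does; yes; no)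
open import Relation.Nullary.Decidable using (_×-dec_; dec-true; dec-false)

ups+downs≡length : ∀ {m} (D : Word m) k → k ≤ m → ups D k + downs D k ≡ k
ups+downs≡length D       zero    _         = refl
ups+downs≡length (u ∷ D) (suc k) (s≤s k≤m) = cong suc (ups+downs≡length D k k≤m)
ups+downs≡length (d ∷ D) (suc k) (s≤s k≤m) =
  trans (+-suc (ups D k) (downs D k)) (cong suc (ups+downs≡length D k k≤m))

UnitStep : ℕ → ℕ → Set
UnitStep a b = b ≡ suc a ⊎ a ≡ suc b

UnitSteps : (ℕ → ℕ) → Set
UnitSteps H = ∀ k → UnitStep (H k) (H (suc k))

upIf : ∀ {A : Set} → Dec A → Step
upIf (yes _) = u
upIf (no _)  = d

stepOf : (ℕ → ℕ) → ℕ → Step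
stepOf H k = upIf (H k <? H (suc k))

wordOf : (m : ℕ) → (ℕ → ℕ) → Word m
wordOf m H = tabulate (stepOf H ∘ toℕ)

<⇒stepOf≡u : ∀ H k → H k < H (suc k) → stepOf H k ≡ u
<⇒stepOf≡u H k lt with H k <? H (suc k)
... | yes _  = refl
... | no ¬lt = ⊥-elim (¬lt lt)

≥⇒stepOf≡d : ∀ H k → H (suc k) ≤ H k → stepOf H k ≡ d
≥⇒stepOf≡d H k ge with H k <? H (suc k)
... | yes lt = ⊥-elim (<⇒≱ lt ge)
... | no _   = refl

ups-stepOf-∷ : ∀ {m} (v : Word m) H k → UnitStep (H 0) (H 1) →
  ups v k + H 1 ≡ downs v k + H (suc k) →
  ups (stepOf H 0 ∷ v) (suc k) + H 0 ≡ downs (stepOf H 0 ∷ v) (suc k) + H (suc k)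
ups-stepOf-∷ v H k (inj₁ up) ih rewrite <⇒stepOf≡u H 0 (≤-reflexive (sym up)) =
  trans (sym (+-suc (ups v k) (H 0))) (trans (cong (ups v k +_) (sym up)) ih)
ups-stepOf-∷ v H k (inj₂ down) ih
  rewrite ≥⇒stepOf≡d H 0 (≤-trans (n≤1+n (H 1)) (≤-reflexive (sym down))) =
  trans (cong (ups v k +_) down) (trans (+-suc (ups v k) (H 1)) (cong suc ih))

ups-wordOf : ∀ {m} H → UnitSteps H → ∀ k → k ≤ m →
  ups (wordOf m H) k + H 0 ≡ downs (wordOf m H) k + H k
ups-wordOf H steps zero _ = refl
ups-wordOf {suc m} H steps (suc k) (s≤s k≤m) =
  ups-stepOf-∷ (wordOf m (H ∘ suc)) H k (steps 0) (ups-wordOf (H ∘ suc) (steps ∘ suc) k k≤m)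

-- For unit-step H, H k is the height before letter k of wordOf m H, and
-- Arc H a b says that the up-step at a is matched with the down-step at b.
Arc : (ℕ → ℕ) → ℕ → ℕ → Set
Arc H a b = a < b × H (suc b) ≡ H a × (∀ z → a < z → z ≤ b → H a < H z)

Arc-functional : ∀ {H a b c} → Arc H a b → Arc H a c → b ≡ c
Arc-functional {b = b} {c} (a<b , back₁ , above₁) (a<c , back₂ , above₂) with <-cmp b c
... | tri≈ _ b≡c _ = b≡c
... | tri< b<c _ _ = ⊥-elim (<-irrefl (sym back₁) (above₂ (suc b) (m<n⇒m<1+n a<b) b<c))
... | tri> _ _ c<b = ⊥-elim (<-irrefl (sym back₂) (above₁ (suc c) (m<n⇒m<1+n a<c) c<b))

Arc-injective : ∀ {H a b c} → Arc H b a → Arc H c a → b ≡ c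
Arc-injective {b = b} {c} (b<a , back₁ , above₁) (c<a , back₂ , above₂) with <-cmp b c
... | tri≈ _ b≡c _ = b≡c
... | tri< b<c _ _ = ⊥-elim (<-irrefl (trans (sym back₁) back₂) (above₁ c b<c (<⇒≤ c<a)))
... | tri> _ _ c<b = ⊥-elim (<-irrefl (trans (sym back₂) back₁) (above₂ b c<b (<⇒≤ b<a)))

¬Arc-chain : ∀ {H a b c} → Arc H c a → Arc H a b → ⊥
¬Arc-chain {H} {a} (c<a , back , above) (a<b , _ , above′) =
  <-asym (above a c<a ≤-refl) (subst (H a <_) back (above′ (suc a) ≤-refl a<b))

TunnelFunctional : ∀ {m} → Word m → Set
TunnelFunctional D = ∀ {a b c} → Tunnel D a b → Tunnel D a c → b ≡ c

Links : ∀ {m} → Word m → ℕ → ℕ → Set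
Links {m} D a b = ∀ {x y : Fin m} → SetEq2 (toℕ x) (toℕ y) a b → Tunnel D x y

Links-swap : ∀ {m} {D : Word m} {a b} → Links D a b → Links D b a
Links-swap links (inj₁ eqs) = links (inj₂ eqs)
Links-swap links (inj₂ eqs) = links (inj₁ eqs)

module WordOfHeights {H : ℕ → ℕ} (steps : UnitSteps H) (start : H 0 ≡ 0) (m : ℕ) where

  D : Word m
  D = wordOf m H

  ups≡downs+height : ∀ {k} → k ≤ m → ups D k ≡ downs D k + H k
  ups≡downs+height {k} k≤m = begin
    ups D k           ≡⟨ +-identityʳ (ups D k) ⟨
    ups D k + 0       ≡⟨ cong (ups D k +_) start ⟨
    ups D k + H 0     ≡⟨ ups-wordOf H steps k k≤m ⟩
    downs D k + H k   ∎
    where open ≡-Reasoning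

  cross-count : ∀ {a b} → a ≤ m → ups D a + downs D b ≡ H a + (downs D a + downs D b)
  cross-count {a} {b} a≤m = begin
    ups D a + downs D b             ≡⟨ cong (_+ downs D b) (ups≡downs+height a≤m) ⟩
    downs D a + H a + downs D b     ≡⟨ cong (_+ downs D b) (+-comm (downs D a) (H a)) ⟩
    H a + downs D a + downs D b     ≡⟨ +-assoc (H a) (downs D a) (downs D b) ⟩
    H a + (downs D a + downs D b)   ∎
    where open ≡-Reasoning

  module _ {a b} (a≤m : a ≤ m) (b≤m : b ≤ m) where

    private
      total : ℕ
      total = downs D a + downs D b

      left : ups D a + downs D b ≡ H a + total
      left = cross-count {b = b} a≤m

      right : ups D b + downs D a ≡ H b + total
      right = trans (cross-count {b = a} b≤m) (cong (H b +_) (+-comm (downs D b) (downs D a)))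

    counts-≡⇒heights-≡ : ups D a + downs D b ≡ ups D b + downs D a → H a ≡ H b
    counts-≡⇒heights-≡ e = +-cancelʳ-≡ total (H a) (H b) (trans (sym left) (trans e right))

    heights-≡⇒counts-≡ : H a ≡ H b → ups D a + downs D b ≡ ups D b + downs D a
    heights-≡⇒counts-≡ e = trans left (trans (cong (_+ total) e) (sym right))

    counts-<⇒heights-< : ups D a + downs D b < ups D b + downs D a → H a < H b
    counts-<⇒heights-< lt = +-cancelʳ-< total (H a) (H b) (subst₂ _<_ left right lt)

    heights-<⇒counts-< : H a < H b → ups D a + downs D b < ups D b + downs D a
    heights-<⇒counts-< lt = subst₂ _<_ (sym left) (sym right) (+-monoˡ-< total lt)

  Matched⇒Arc : ∀ {x y} → Matched D x y → Arc H (toℕ x) (toℕ y)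
  Matched⇒Arc {x} {y} (x<y , _ , balanced , between) =
    x<y , counts-≡⇒heights-≡ (toℕ<n y) (<⇒≤ (toℕ<n x)) balanced , above
    where
    above : ∀ z → toℕ x < z → z ≤ toℕ y → H (toℕ x) < H z
    above z x<z z≤y = subst (λ t → H (toℕ x) < H t) (toℕ-fromℕ< z<m)
      (counts-<⇒heights-< (<⇒≤ (toℕ<n x)) (<⇒≤ (toℕ<n z′))
        (between z′ (subst (toℕ x <_) (sym (toℕ-fromℕ< z<m)) x<z)
                    (subst (_≤ toℕ y) (sym (toℕ-fromℕ< z<m)) z≤y)))
      where
      z<m = ≤-<-trans z≤y (toℕ<n y)
      z′ = fromℕ< z<m

  Arc⇒Matched : ∀ {x y} → Arc H (toℕ x) (toℕ y) → Matched D x y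
  Arc⇒Matched {x} {y} (x<y , back , above) =
    x<y ,
    trans (lookup∘tabulate (stepOf H ∘ toℕ) x) (<⇒stepOf≡u H (toℕ x) (above _ ≤-refl x<y)) ,
    heights-≡⇒counts-≡ (toℕ<n y) (<⇒≤ (toℕ<n x)) back ,
    λ z x<z z≤y → heights-<⇒counts-< (<⇒≤ (toℕ<n x)) (<⇒≤ (toℕ<n z)) (above (toℕ z) x<z z≤y)

  Arc⇒Links : ∀ {a b} → Arc H a b → Links D a b
  Arc⇒Links arc (inj₁ (x≡a , y≡b)) = inj₁ (Arc⇒Matched (subst₂ (Arc H) (sym x≡a) (sym y≡b) arc))
  Arc⇒Links arc (inj₂ (x≡b , y≡a)) = inj₂ (Arc⇒Matched (subst₂ (Arc H) (sym y≡a) (sym x≡b) arc))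

  Tunnel-functional : TunnelFunctional D
  Tunnel-functional {a} {b} {c} t₁ t₂ = toℕ-injective (positions t₁ t₂)
    where
    positions : Tunnel D a b → Tunnel D a c → toℕ b ≡ toℕ c
    positions (inj₁ ab) (inj₁ ac) = Arc-functional (Matched⇒Arc ab) (Matched⇒Arc ac)
    positions (inj₂ ba) (inj₂ ca) = Arc-injective (Matched⇒Arc ba) (Matched⇒Arc ca)
    positions (inj₁ ab) (inj₂ ca) = ⊥-elim (¬Arc-chain (Matched⇒Arc ca) (Matched⇒Arc ab))
    positions (inj₂ ba) (inj₁ ac) = ⊥-elim (¬Arc-chain (Matched⇒Arc ba) (Matched⇒Arc ac))

wordOf-isDyck : ∀ n {H} → UnitSteps H → H 0 ≡ 0 → H (2 * n) ≡ 0 → IsDyck n (wordOf (2 * n) H)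
wordOf-isDyck n {H} steps start end =
  trans balanced downs≡n , downs≡n ,
  λ k k≤2n → subst (downs D k ≤_) (sym (ups≡downs+height k≤2n)) (m≤m+n (downs D k) _)
  where
  open WordOfHeights steps start (2 * n)
  open ≡-Reasoning
  balanced : ups D (2 * n) ≡ downs D (2 * n)
  balanced = begin
    ups D (2 * n)               ≡⟨ ups≡downs+height ≤-refl ⟩
    downs D (2 * n) + H (2 * n) ≡⟨ cong (downs D (2 * n) +_) end ⟩
    downs D (2 * n) + 0         ≡⟨ +-identityʳ _ ⟩
    downs D (2 * n)             ∎
  downs≡n : downs D (2 * n) ≡ n
  downs≡n = *-cancelˡ-≡ (downs D (2 * n)) n 2 (begin
    2 * downs D (2 * n)               ≡⟨ cong (downs D (2 * n) +_) (+-identityʳ _) ⟩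
    downs D (2 * n) + downs D (2 * n) ≡⟨ cong (_+ downs D (2 * n)) balanced ⟨
    ups D (2 * n) + downs D (2 * n)   ≡⟨ ups+downs≡length D (2 * n) ≤-refl ⟩
    2 * n                             ∎)

module _ {m} (σ : Permutation′ m) (D : Word m) where

  ClosedAt : Fin m → Set
  ClosedAt k = ∃ λ l → toℕ l ≤ toℕ k × Tunnel D (σ ⟨$⟩ʳ k) (σ ⟨$⟩ʳ l)

  closedAt? : ∀ k → Dec (ClosedAt k)
  closedAt? k = any? (λ l → (toℕ l ≤? toℕ k) ×-dec Tunnel? D (σ ⟨$⟩ʳ k) (σ ⟨$⟩ʳ l))

  lookup-σpath : ∀ k → lookup (σpath σ D) k ≡ (if does (closedAt? k) then d else u)
  lookup-σpath = lookup∘tabulate _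

  σpath-closing : ∀ {k a} → toℕ a ≤ toℕ k → Tunnel D (σ ⟨$⟩ʳ k) (σ ⟨$⟩ʳ a) →
    lookup (σpath σ D) k ≡ d
  σpath-closing {k} a≤k t =
    trans (lookup-σpath k) (cong (if_then d else u) (dec-true (closedAt? k) (_ , a≤k , t)))

  σpath-opening : TunnelFunctional D → ∀ {k b} → toℕ k < toℕ b →
    Tunnel D (σ ⟨$⟩ʳ k) (σ ⟨$⟩ʳ b) → lookup (σpath σ D) k ≡ u
  σpath-opening functional {k} {b} k<b t =
    trans (lookup-σpath k) (cong (if_then d else u) (dec-false (closedAt? k) notClosed))
    where
    notClosed : ¬ ClosedAt k
    notClosed (l , l≤k , t′) = <⇒≱ k<b (subst (λ x → toℕ x ≤ toℕ k) l≡b l≤k)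
      where
      l≡b : l ≡ b
      l≡b = trans (sym (inverseˡ σ)) (trans (cong (σ ⟨$⟩ˡ_) (functional t′ t)) (inverseˡ σ))

σpath-separates : ∀ {m} {D : Word m} → TunnelFunctional D → (λ′ μ : Permutation′ m) →
  ∀ {i j k} → toℕ i < toℕ j → toℕ j < toℕ k →
  Tunnel D (λ′ ⟨$⟩ʳ i) (λ′ ⟨$⟩ʳ j) → Tunnel D (μ ⟨$⟩ʳ j) (μ ⟨$⟩ʳ k) →
  σpath λ′ D ≢ σpath μ D
σpath-separates functional λ′ μ {i} {j} i<j j<k tλ tμ same = d≢u (begin
  d                         ≡⟨ σpath-closing λ′ _ (<⇒≤ i<j) (swap tλ) ⟨
  lookup (σpath λ′ _) j     ≡⟨ cong (λ w → lookup w j) same ⟩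
  lookup (σpath μ _) j      ≡⟨ σpath-opening μ _ functional j<k tμ ⟩
  u                         ∎)
  where
  open ≡-Reasoning
  d≢u : d ≢ u
  d≢u ()

zigzag : ℕ → ℕ
zigzag 0 = 0
zigzag 1 = 1
zigzag (suc (suc k)) = zigzag k

zigzag-cases : ∀ k → (zigzag k ≡ 0 × zigzag (suc k) ≡ 1) ⊎ (zigzag k ≡ 1 × zigzag (suc k) ≡ 0)
zigzag-cases 0 = inj₁ (refl , refl)
zigzag-cases 1 = inj₂ (refl , refl)
zigzag-cases (suc (suc k)) = zigzag-cases k

zigzag-unitSteps : UnitSteps zigzag
zigzag-unitSteps k with zigzag-cases k
... | inj₁ (z₀ , z₁) = inj₁ (trans z₁ (cong suc (sym z₀)))
... | inj₂ (z₁ , z₀) = inj₂ (trans z₁ (cong suc (sym z₀)))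

zigzag-+ : ∀ a b → zigzag a ≡ zigzag b → zigzag (a + b) ≡ 0
zigzag-+ 0 b e = sym e
zigzag-+ 1 b e with zigzag-cases b
... | inj₁ (z₀ , _) = ⊥-elim (1+n≢0 (trans e z₀))
... | inj₂ (_ , z₀) = z₀
zigzag-+ (suc (suc a)) b e = zigzag-+ a b e

zigzag-suc : ∀ a b → zigzag a ≢ zigzag b → zigzag (suc a) ≡ zigzag b
zigzag-suc a b ne with zigzag-cases a | zigzag-cases b
... | inj₁ (za , _)  | inj₁ (zb , _) = ⊥-elim (ne (trans za (sym zb)))
... | inj₁ (_ , za′) | inj₂ (zb , _) = trans za′ (sym zb)
... | inj₂ (_ , za′) | inj₁ (zb , _) = trans za′ (sym zb)
... | inj₂ (za , _)  | inj₂ (zb , _) = ⊥-elim (ne (trans za (sym zb)))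

zigzag≡%2 : ∀ k → zigzag k ≡ k % 2
zigzag≡%2 0 = refl
zigzag≡%2 1 = refl
zigzag≡%2 (suc (suc k)) =
  trans (zigzag≡%2 k) (trans (sym ([m+n]%n≡m%n k 2)) (cong (_% 2) (+-comm k 2)))

zigzag-≢ : ∀ a b → a % 2 ≢ b % 2 → zigzag a ≢ zigzag b
zigzag-≢ a b ne e = ne (trans (sym (zigzag≡%2 a)) (trans e (zigzag≡%2 b)))

zigzag-double : ∀ n → zigzag (2 * n) ≡ 0
zigzag-double n = zigzag-+ n (n + 0) (cong zigzag (sym (+-identityʳ n)))

<-suc-≢⇒< : ∀ {m n} → m < suc n → n ≢ m → m < n
<-suc-≢⇒< m<sn n≢m = ≤∧≢⇒< (s≤s⁻¹ m<sn) (n≢m ∘ sym)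

UnitStep-suc-+ : ∀ c {a b} → UnitStep a b → UnitStep (suc (c + a)) (suc (c + b))
UnitStep-suc-+ c {a} {b} (inj₁ up)   = inj₁ (cong suc (trans (cong (c +_) up) (+-suc c a)))
UnitStep-suc-+ c {a} {b} (inj₂ down) = inj₂ (cong suc (trans (cong (c +_) down) (+-suc c b)))

-- On (q, r] the zigzag is restarted one level above zigzag q; since r - q
-- is odd, it comes back down to zigzag q exactly at r + 1.
module RaisedZigzag (q r : ℕ) (q<r : q < r) (opposite : zigzag q ≢ zigzag r) where

  height : ℕ → ℕ
  height k with q <? k | k ≤? r
  ... | yes _ | yes _ = suc (zigzag q + zigzag (suc k + q))
  ... | _     | _     = zigzag k

  height-inside : ∀ {k} → q < k → k ≤ r → height k ≡ suc (zigzag q + zigzag (suc k + q))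
  height-inside {k} q<k k≤r with q <? k | k ≤? r
  ... | yes _ | yes _  = refl
  ... | no ¬q<k | _    = ⊥-elim (¬q<k q<k)
  ... | yes _ | no ¬k≤r = ⊥-elim (¬k≤r k≤r)

  height-below : ∀ {k} → k ≤ q → height k ≡ zigzag k
  height-below {k} k≤q with q <? k | k ≤? r
  ... | yes q<k | yes _ = ⊥-elim (<⇒≱ q<k k≤q)
  ... | yes _   | no _  = refl
  ... | no _    | _     = refl

  height-above : ∀ {k} → r < k → height k ≡ zigzag k
  height-above {k} r<k with q <? k | k ≤? r
  ... | yes _ | yes k≤r = ⊥-elim (<⇒≱ r<k k≤r)
  ... | yes _ | no _    = refl
  ... | no _  | _       = refl

  height-suc-q : height (suc q) ≡ suc (zigzag q)
  height-suc-q = trans (height-inside ≤-refl q<r)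
    (cong suc (trans (cong (zigzag q +_) (zigzag-+ q q refl)) (+-identityʳ _)))

  zigzag-suc-r : zigzag (suc r) ≡ zigzag q
  zigzag-suc-r = zigzag-suc r q (opposite ∘ sym)

  height-r : height r ≡ suc (zigzag q)
  height-r = trans (height-inside q<r ≤-refl)
    (cong suc (trans (cong (zigzag q +_) (zigzag-+ (suc r) q zigzag-suc-r)) (+-identityʳ _)))

  height-suc-r : height (suc r) ≡ zigzag q
  height-suc-r = trans (height-above ≤-refl) zigzag-suc-r

  height-unitSteps : UnitSteps height
  height-unitSteps k with <-cmp k q
  ... | tri< k<q _ _ rewrite height-below (<⇒≤ k<q) | height-below k<q = zigzag-unitSteps k
  ... | tri≈ _ refl _ rewrite height-below (≤-refl {q}) | height-suc-q = inj₁ refl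
  ... | tri> _ _ q<k with <-cmp k r
  ...   | tri< k<r _ _ rewrite height-inside q<k (<⇒≤ k<r) | height-inside (m<n⇒m<1+n q<k) k<r =
            UnitStep-suc-+ (zigzag q) (zigzag-unitSteps (suc k + q))
  ...   | tri≈ _ refl _ rewrite height-r | height-suc-r = inj₂ refl
  ...   | tri> _ _ r<k rewrite height-above r<k | height-above (m<n⇒m<1+n r<k) = zigzag-unitSteps k

  height-Arc : Arc height q r
  height-Arc = q<r , trans height-suc-r (sym (height-below ≤-refl)) , above
    where
    above : ∀ z → q < z → z ≤ r → height q < height z
    above z q<z z≤r rewrite height-below (≤-refl {q}) | height-inside q<z z≤r =
      s≤s (m≤m+n (zigzag q) _)

  height-2-periodic : ∀ {P} → P ≢ q → P ≢ r → suc P ≢ q → suc P ≢ r →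
    height (suc (suc P)) ≡ height P
  height-2-periodic {P} P≢q P≢r sP≢q sP≢r with <-cmp (suc P) q
  ... | tri< sP<q _ _ = trans (height-below sP<q) (sym (height-below (<⇒≤ (<-trans (n<1+n P) sP<q))))
  ... | tri≈ _ sP≡q _ = ⊥-elim (sP≢q sP≡q)
  ... | tri> _ _ q<sP with <-cmp (suc P) r
  ...   | tri< sP<r _ _ = trans (height-inside (m<n⇒m<1+n (m<n⇒m<1+n q<P)) sP<r)
                                (sym (height-inside q<P (<⇒≤ (<-trans (n<1+n P) sP<r))))
    where q<P = <-suc-≢⇒< q<sP P≢q
  ...   | tri≈ _ sP≡r _ = ⊥-elim (sP≢r sP≡r)
  ...   | tri> _ _ r<sP = trans (height-above (m<n⇒m<1+n (m<n⇒m<1+n r<P))) (sym (height-above r<P))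
    where r<P = <-suc-≢⇒< r<sP P≢r

withPeak : (ℕ → ℕ) → ℕ → ℕ → ℕ
withPeak G P k with k ≟ suc P
... | yes _ = suc (G P)
... | no _  = G k

module _ (G : ℕ → ℕ) (P : ℕ) where

  withPeak-peak : withPeak G P (suc P) ≡ suc (G P)
  withPeak-peak with suc P ≟ suc P
  ... | yes _ = refl
  ... | no ≢  = ⊥-elim (≢ refl)

  withPeak-else : ∀ {k} → k ≢ suc P → withPeak G P k ≡ G k
  withPeak-else {k} k≢sP with k ≟ suc P
  ... | yes k≡sP = ⊥-elim (k≢sP k≡sP)
  ... | no _     = refl

  withPeak-unitSteps : UnitSteps G → G (suc (suc P)) ≡ G P → UnitSteps (withPeak G P)
  withPeak-unitSteps steps period k with <-cmp k P
  ... | tri< k<P _ _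
    rewrite withPeak-else (<⇒≢ (<-trans k<P (n<1+n P))) | withPeak-else (<⇒≢ (s≤s k<P)) = steps k
  ... | tri≈ _ refl _ rewrite withPeak-else (<⇒≢ (n<1+n P)) | withPeak-peak = inj₁ refl
  ... | tri> _ _ P<k with <-cmp k (suc P)
  ...   | tri< k<sP _ _ = ⊥-elim (<⇒≱ P<k (s≤s⁻¹ k<sP))
  ...   | tri≈ _ refl _
    rewrite withPeak-peak | withPeak-else (>⇒≢ (n<1+n (suc P))) | period = inj₂ refl
  ...   | tri> _ _ sP<k
    rewrite withPeak-else (>⇒≢ sP<k) | withPeak-else (>⇒≢ (m<n⇒m<1+n sP<k)) = steps k

  withPeak-Arc : G (suc (suc P)) ≡ G P → Arc (withPeak G P) P (suc P)
  withPeak-Arc period = n<1+n P , back , above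
    where
    start : withPeak G P P ≡ G P
    start = withPeak-else (<⇒≢ (n<1+n P))
    back : withPeak G P (suc (suc P)) ≡ withPeak G P P
    back = trans (withPeak-else (>⇒≢ (n<1+n (suc P)))) (trans period (sym start))
    above : ∀ z → P < z → z ≤ suc P → withPeak G P P < withPeak G P z
    above z P<z z≤sP rewrite ≤-antisym z≤sP P<z | start | withPeak-peak = n<1+n (G P)

  withPeak-preserves-Arc : ∀ {a b} → Arc G a b → a ≢ suc P → b ≢ P → Arc (withPeak G P) a b
  withPeak-preserves-Arc {a} {b} (a<b , back , above) a≢sP b≢P =
    a<b ,
    trans (withPeak-else (b≢P ∘ suc-injective)) (trans back (sym (withPeak-else a≢sP))) ,
    λ z a<z z≤b → subst (_< withPeak G P z) (sym (withPeak-else a≢sP)) (above′ z a<z z≤b)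
    where
    -- the peak at P + 1 ∈ (a, b] rises above G P, and G a ≤ G P since P ∈ [a, b]
    above′ : ∀ z → a < z → z ≤ b → G a < withPeak G P z
    above′ z a<z z≤b with z ≟ suc P
    ... | no _ = above z a<z z≤b
    ... | yes refl with a ≟ P
    ...   | yes refl = n<1+n (G a)
    ...   | no a≢P   = m<n⇒m<1+n (above P (<-suc-≢⇒< a<z (a≢P ∘ sym)) (<⇒≤ z≤b))

linkingDyckPath-< : ∀ n {P q r} → suc P < 2 * n → r < 2 * n → q < r → zigzag q ≢ zigzag r →
  P ≢ q → P ≢ r → suc P ≢ q → suc P ≢ r →
  ∃ λ (D : Word (2 * n)) → IsDyck n D × TunnelFunctional D × Links D P (suc P) × Links D q r
linkingDyckPath-< n {P} {q} {r} sP<2n r<2n q<r opposite P≢q P≢r sP≢q sP≢r =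
  D , wordOf-isDyck n steps start end , Tunnel-functional ,
  Arc⇒Links (withPeak-Arc G P period) ,
  Arc⇒Links (withPeak-preserves-Arc G P height-Arc (sP≢q ∘ sym) (P≢r ∘ sym))
  where
  open RaisedZigzag q r q<r opposite renaming (height to G)
  H : ℕ → ℕ
  H = withPeak G P
  period : G (suc (suc P)) ≡ G P
  period = height-2-periodic P≢q P≢r sP≢q sP≢r
  steps : UnitSteps H
  steps = withPeak-unitSteps G P height-unitSteps period
  start : H 0 ≡ 0
  start = trans (withPeak-else G P {0} (λ ())) (height-below z≤n)
  end : H (2 * n) ≡ 0
  end = trans (withPeak-else G P (λ 2n≡sP → <-irrefl (sym 2n≡sP) sP<2n))
              (trans (height-above r<2n) (zigzag-double n))
  open WordOfHeights steps start (2 * n)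

linkingDyckPath : ∀ n {P Q R} → suc P < 2 * n → Q < 2 * n → R < 2 * n → Q % 2 ≢ R % 2 →
  P ≢ Q → P ≢ R → suc P ≢ Q → suc P ≢ R →
  ∃ λ (D : Word (2 * n)) → IsDyck n D × TunnelFunctional D × Links D P (suc P) × Links D Q R
linkingDyckPath n {P} {Q} {R} sP<2n Q<2n R<2n Q≢R%2 P≢Q P≢R sP≢Q sP≢R with <-cmp Q R
... | tri< Q<R _ _ =
  linkingDyckPath-< n sP<2n R<2n Q<R (zigzag-≢ Q R Q≢R%2) P≢Q P≢R sP≢Q sP≢R
... | tri≈ _ refl _ = ⊥-elim (Q≢R%2 refl)
... | tri> _ _ R<Q with linkingDyckPath-< n sP<2n Q<2n R<Q (zigzag-≢ R Q (Q≢R%2 ∘ sym)) P≢R P≢Q sP≢R sP≢Q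
...   | D , isDyck , functional , peak , linkRQ = D , isDyck , functional , peak , Links-swap linkRQ

lemma2 : (n : ℕ) → 3 ≤ n → (λ′ μ : Permutation′ (2 * n)) →
    (Σ (ℕ × ℕ) λ p → Par λ′ p × Par μ p) →
    (Σ (Fin (2 * n)) λ i → Σ (Fin (2 * n)) λ j → Σ (Fin (2 * n)) λ k → DestroyingTriple λ′ μ i j k) →
    ¬ (_∼_ {n} λ′ μ)
lemma2 n _ λ′ μ _
  (i , j , k , i<j , j<k , P , Q , R , sP<2n , Q<2n , R<2n , P≢Q , P≢R , sP≢Q , sP≢R , _ , Q≢R%2 , pairs)
  λ′∼μ
  with linkingDyckPath n sP<2n Q<2n R<2n Q≢R%2 P≢Q P≢R sP≢Q sP≢R
... | D , isDyck , functional , peak , linkQR =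
  [ (λ (λij , μjk) → σpath-separates functional λ′ μ i<j j<k (peak λij) (linkQR μjk))
  , (λ (λij , μjk) → σpath-separates functional λ′ μ i<j j<k (linkQR λij) (peak μjk))
  ]′ pairs (λ′∼μ D isDyck)
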